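{- Let $G=(A\cup B,E)$ be a well-edge-dominated bipartite graph with bipartition $A,B$ and $|A|<|B|$. If $y\in A$ is not a support vertex in $G$, then there exists a minimal edge dominating set $F$ of $G$ that contains no edge incident to $y$.
   Context: A set $F\subseteq E(G)$ is an edge dominating set if every edge of $G$ is in $F$ or shares an endpoint with an edge of $F$; it is minimal if no proper subset is an edge dominating set. $G$ is well-edge-dominated if all minimal edge dominating sets of $G$ have the same cardinality. A support vertex is a vertex adjacent to a vertex of degree one. -}

module Defs where

open import Data.Nat using (ℕ; _<_)
open import Data.Fin using (Fin; _<_)
open import Data.Fin.Properties using (_<?_)
open import Data.Bool using (Bool; true; false; T; _∧_; not)
open import Data.Product using (Σ; _×_; ∃-syntax; _,_)
open import Data.Sum using (_⊎_)
open import Data.Empty using (⊥)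
open import Data.List using (List; length; filter)
open import Data.List.Base using (allFin)
open import Data.List using (concatMap; map)
open import Relation.Nullary using (¬_; Dec; yes; no)
open import Relation.Nullary.Decidable using (⌊_⌋)
open import Relation.Binary.PropositionalEquality using (_≡_)

record Graph (n : ℕ) : Set where
  field
    adj    : Fin n → Fin n → Bool
    sym    : ∀ u v → adj u v ≡ adj v u
    irrefl : ∀ v → adj v v ≡ false
open Graph public

record EdgeSet {n : ℕ} (G : Graph n) : Set where
  field
    mem   : Fin n → Fin n → Bool
    memSym : ∀ u v → mem u v ≡ mem v u
    sub   : ∀ u v → T (mem u v) → T (adj G u v)
open EdgeSet public

allPairs : (n : ℕ) → List (Fin n × Fin n)
allPairs n = concatMap (λ u → map (λ v → (u , v)) (allFin n)) (allFin n)

edgeCount : ∀ {n} {G : Graph n} → EdgeSet G → ℕ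
edgeCount {n} F =
  length (filter (λ { (u , v) → Data.Bool.T? (mem F u v ∧ ⌊ u <? v ⌋) }) (allPairs n))

_⊆E_ : ∀ {n} {G : Graph n} → EdgeSet G → EdgeSet G → Set
F ⊆E F' = ∀ u v → T (mem F u v) → T (mem F' u v)

_⊂E_ : ∀ {n} {G : Graph n} → EdgeSet G → EdgeSet G → Set
F ⊂E F' = F ⊆E F' × ∃[ u ] ∃[ v ] (T (mem F' u v) × ¬ T (mem F u v))

-- The edge {u,v} is in F or shares an endpoint with an edge of F.
-- (An edge {w,x} shares an endpoint with {u,v} iff one of w,x is u or v;
--  by symmetry of F we may take w ∈ {u,v}.)
Dominated : ∀ {n} {G : Graph n} → EdgeSet G → Fin n → Fin n → Set
Dominated F u v = T (mem F u v) ⊎ (∃[ x ] (T (mem F u x) ⊎ T (mem F v x)))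

IsEDS : ∀ {n} {G : Graph n} → EdgeSet G → Set
IsEDS {G = G} F = ∀ u v → T (adj G u v) → Dominated F u v

IsMinimalEDS : ∀ {n} {G : Graph n} → EdgeSet G → Set
IsMinimalEDS {G = G} F = IsEDS F × (∀ (F' : EdgeSet G) → F' ⊂E F → ¬ IsEDS F')

WellEdgeDominated : ∀ {n} → Graph n → Set
WellEdgeDominated G = ∀ (F F' : EdgeSet G) → IsMinimalEDS F → IsMinimalEDS F'
                      → edgeCount F ≡ edgeCount F'

degree : ∀ {n} → Graph n → Fin n → ℕ
degree {n} G v = length (filter (λ w → Data.Bool.T? (adj G v w)) (allFin n))

IsSupport : ∀ {n} → Graph n → Fin n → Set
IsSupport G v = ∃[ w ] (T (adj G v w) × degree G w ≡ 1)

-- Bipartition given by a side function (false = A, true = B):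
-- every edge joins A and B.
IsBipartition : ∀ {n} → Graph n → (Fin n → Bool) → Set
IsBipartition G side = ∀ u v → T (adj G u v) → side u ≡ not (side v)

sizeA : ∀ {n} → (Fin n → Bool) → ℕ
sizeA {n} side = length (filter (λ v → Data.Bool.T? (not (side v))) (allFin n))

sizeB : ∀ {n} → (Fin n → Bool) → ℕ
sizeB {n} side = length (filter (λ v → Data.Bool.T? (side v)) (allFin n))

{-# OPTIONS --safe #-}
-- If y is not a support vertex, every neighbour w of y has a second neighbour
-- x ≠ y, so the edge wx of G − y dominates yw.  Hence E(G − y) is an edge
-- dominating set of G, and greedily deleting edges from it while it stays
-- dominating yields a minimal edge dominating set avoiding y.
module Submission where

open import Defs hiding (sym)
open import Data.Nat using (ℕ; _<_; suc)
open import Data.Fin using (Fin; zero; suc; _≟_)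
open import Data.Fin.Properties using (all?; any?; 0≢1+n; suc-injective)
open import Data.Bool using (Bool; false; T; T?; _∧_; not)
open import Data.Bool.Properties using (T-∧; ∧-comm)
open import Data.Product using (_×_; _,_; proj₁; proj₂; ∃-syntax)
open import Data.Sum using (_⊎_; inj₁; inj₂; swap)
open import Data.List using (List; []; _∷_; length; filter; tabulate; allFin; cartesianProduct)
open import Data.List.Properties using (filter-accept; filter-reject; filter-none)
open import Data.List.Relation.Unary.All.Properties using (tabulate⁺)
open import Data.List.Membership.Propositional using (_∈_)
open import Data.List.Relation.Unary.Any using (here; there)
open import Data.List.Membership.Propositional.Properties using (∈-allFin; ∈-cartesianProduct⁺)
open import Function using (_∘_)
open import Function.Bundles using (mk⇔; Equivalence)
open import Level using (0ℓ)
open import Relation.Unary using (Pred; Decidable)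
open import Relation.Nullary using (¬_; Dec; does; yes; no; ¬?; contradiction)
open import Relation.Nullary.Decidable
  using ( ⌊_⌋; does-⇔; isYes≗does; decidable-stable; toWitnessFalse; fromWitnessFalse
        ; _→-dec_; _⊎-dec_; _×-dec_)
open import Relation.Binary.PropositionalEquality using (_≡_; _≢_; refl; sym; cong; cong₂; subst; module ≡-Reasoning)

open Equivalence using (to; from)

length-filter-tabulate-unique :
  ∀ {a} {A : Set} {m} (h : Fin m → A) {P : Pred A a} (P? : Decidable P) (i : Fin m) →
  P (h i) → (∀ j → P (h j) → j ≡ i) → length (filter P? (tabulate h)) ≡ 1
length-filter-tabulate-unique h P? zero Phi unique
  rewrite filter-accept P? {xs = tabulate (h ∘ suc)} Phi =
    cong (suc ∘ length) (filter-none P? (tabulate⁺ λ j → 0≢1+n ∘ sym ∘ unique (suc j)))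
length-filter-tabulate-unique h P? (suc i) Phi unique
  rewrite filter-reject P? {xs = tabulate (h ∘ suc)} (0≢1+n ∘ unique zero) =
    length-filter-tabulate-unique (h ∘ suc) P? i Phi (λ j → suc-injective ∘ unique (suc j))

SameEdge : ∀ {n} → Fin n → Fin n → Fin n → Fin n → Set
SameEdge a b u v = (a ≡ u × b ≡ v) ⊎ (a ≡ v × b ≡ u)

sameEdge? : ∀ {n} (a b u v : Fin n) → Dec (SameEdge a b u v)
sameEdge? a b u v = (a ≟ u ×-dec b ≟ v) ⊎-dec (a ≟ v ×-dec b ≟ u)

sameEdge?-swap : ∀ {n} (a b u v : Fin n) → ⌊ sameEdge? a b u v ⌋ ≡ ⌊ sameEdge? a b v u ⌋
sameEdge?-swap a b u v = begin
  ⌊ sameEdge? a b u v ⌋    ≡⟨ isYes≗does (sameEdge? a b u v) ⟩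
  does (sameEdge? a b u v) ≡⟨ does-⇔ (mk⇔ swap swap) (sameEdge? a b u v) (sameEdge? a b v u) ⟩
  does (sameEdge? a b v u) ≡⟨ isYes≗does (sameEdge? a b v u) ⟨
  ⌊ sameEdge? a b v u ⌋    ∎
  where open ≡-Reasoning

edgesAvoiding : ∀ {n} (G : Graph n) → Fin n → EdgeSet G
edgesAvoiding G y = record
  { mem    = λ u v → adj G u v ∧ not ⌊ u ≟ y ⌋ ∧ not ⌊ v ≟ y ⌋
  ; memSym = λ u v → cong₂ _∧_ (Graph.sym G u v) (∧-comm (not ⌊ u ≟ y ⌋) _)
  ; sub    = λ u v → proj₁ ∘ to T-∧
  }

module _ {n : ℕ} {G : Graph n} where

  adj⇒≢ : ∀ {u v} → T (adj G u v) → u ≢ v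
  adj⇒≢ {u} uv refl = subst T (irrefl G u) uv

  uniqueNeighbour⇒degree≡1 : ∀ {w y} → T (adj G w y) → (∀ x → T (adj G w x) → x ≡ y) →
                             degree G w ≡ 1
  uniqueNeighbour⇒degree≡1 {w} {y} =
    length-filter-tabulate-unique (λ x → x) (T? ∘ adj G w) y

  ¬support⇒otherNeighbour : ∀ {y w} → ¬ IsSupport G y → T (adj G y w) →
                            ∃[ x ] (T (adj G w x) × x ≢ y)
  ¬support⇒otherNeighbour {y} {w} ¬support yw
    with any? (λ x → T? (adj G w x) ×-dec ¬? (x ≟ y))
  ... | yes other = other
  ... | no ¬other = contradiction (w , yw , uniqueNeighbour⇒degree≡1 wy unique) ¬support
    where
    wy : T (adj G w y)
    wy = subst T (Graph.sym G y w) yw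

    unique : ∀ x → T (adj G w x) → x ≡ y
    unique x wx = decidable-stable (x ≟ y) (λ x≢y → ¬other (x , wx , x≢y))

  UpwardClosed : Pred (EdgeSet G) 0ℓ → Set
  UpwardClosed P = ∀ {F F′} → F ⊆E F′ → P F → P F′

  Minimal : Pred (EdgeSet G) 0ℓ → Pred (EdgeSet G) 0ℓ
  Minimal P F = P F × (∀ F′ → F′ ⊂E F → ¬ P F′)

  removeEdge : Fin n → Fin n → EdgeSet G → EdgeSet G
  removeEdge a b F = record
    { mem    = λ u v → mem F u v ∧ not ⌊ sameEdge? a b u v ⌋
    ; memSym = λ u v → cong₂ _∧_ (memSym F u v) (cong not (sameEdge?-swap a b u v))
    ; sub    = λ u v → sub F u v ∘ proj₁ ∘ to T-∧
    }

  removeEdge-⊆ : ∀ a b F → removeEdge a b F ⊆E F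
  removeEdge-⊆ a b F u v = proj₁ ∘ to (T-∧ {mem F u v})

  removeEdge-mono : ∀ a b {F F′} → F ⊆E F′ → removeEdge a b F ⊆E removeEdge a b F′
  removeEdge-mono a b {F} F⊆F′ u v uv =
    let uv∈F , ¬same = to (T-∧ {mem F u v}) uv in from T-∧ (F⊆F′ u v uv∈F , ¬same)

  removeEdge-removes : ∀ a b F → ¬ T (mem (removeEdge a b F) a b)
  removeEdge-removes a b F ab =
    toWitnessFalse {a? = sameEdge? a b a b} (proj₂ (to (T-∧ {mem F a b}) ab)) (inj₁ (refl , refl))

  ⊆-removeEdge : ∀ {a b F F′} → F′ ⊆E F → ¬ T (mem F′ a b) → F′ ⊆E removeEdge a b F
  ⊆-removeEdge {a} {b} {F} {F′} F′⊆F ab∉F′ u v uv =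
    from T-∧ (F′⊆F u v uv , fromWitnessFalse {a? = sameEdge? a b u v} ¬same)
    where
    ¬same : ¬ SameEdge a b u v
    ¬same (inj₁ (refl , refl)) = ab∉F′ uv
    ¬same (inj₂ (refl , refl)) = ab∉F′ (subst T (memSym F′ u v) uv)

  module Pruning (P : Pred (EdgeSet G) 0ℓ) (P? : Decidable P) (P-up : UpwardClosed P) where

    prune : List (Fin n × Fin n) → EdgeSet G → EdgeSet G
    prune []              F = F
    prune ((a , b) ∷ abs) F with P? (removeEdge a b F)
    ... | yes _ = prune abs (removeEdge a b F)
    ... | no  _ = prune abs F

    prune-⊆ : ∀ abs F → prune abs F ⊆E F
    prune-⊆ []              F u v uv = uv
    prune-⊆ ((a , b) ∷ abs) F u v uv with P? (removeEdge a b F)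
    ... | yes _ = removeEdge-⊆ a b F u v (prune-⊆ abs (removeEdge a b F) u v uv)
    ... | no  _ = prune-⊆ abs F u v uv

    prune-preserves : ∀ abs {F} → P F → P (prune abs F)
    prune-preserves []              PF = PF
    prune-preserves ((a , b) ∷ abs) {F} PF with P? (removeEdge a b F)
    ... | yes P[F-ab] = prune-preserves abs P[F-ab]
    ... | no  _       = prune-preserves abs PF

    -- Removing ab was rejected for a superset of the final set; upward closure keeps it rejected.
    prune-irreducible : ∀ abs F {a b} → (a , b) ∈ abs → T (mem (prune abs F) a b) →
                        ¬ P (removeEdge a b (prune abs F))
    prune-irreducible ((a , b) ∷ abs) F (here refl) ab with P? (removeEdge a b F)
    ... | yes _       = contradiction (prune-⊆ abs (removeEdge a b F) a b ab) (removeEdge-removes a b F)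
    ... | no ¬P[F-ab] =
      ¬P[F-ab] ∘ P-up {F′ = removeEdge a b F} (removeEdge-mono a b {prune abs F} {F} (prune-⊆ abs F))
    prune-irreducible ((c , d) ∷ abs) F (there ab∈abs) ab with P? (removeEdge c d F)
    ... | yes _ = prune-irreducible abs (removeEdge c d F) ab∈abs ab
    ... | no  _ = prune-irreducible abs F ab∈abs ab

    minimal-⊆ : ∀ {F} → P F → ∃[ F′ ] (F′ ⊆E F × Minimal P F′)
    minimal-⊆ {F} PF = prune pairs F , prune-⊆ pairs F , prune-preserves pairs PF , minimal
      where
      pairs : List (Fin n × Fin n)
      pairs = cartesianProduct (allFin n) (allFin n)

      minimal : ∀ F′ → F′ ⊂E prune pairs F → ¬ P F′
      minimal F′ (F′⊆ , u , v , uv∈ , uv∉F′) =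
        prune-irreducible pairs F (∈-cartesianProduct⁺ (∈-allFin u) (∈-allFin v)) uv∈
        ∘ P-up {F′ = removeEdge u v (prune pairs F)}
               (⊆-removeEdge {F = prune pairs F} {F′} F′⊆ uv∉F′)

  IsEDS-upwardClosed : UpwardClosed IsEDS
  IsEDS-upwardClosed F⊆F′ isEDS u v uv with isEDS u v uv
  ... | inj₁ u~v = inj₁ (F⊆F′ u v u~v)
  ... | inj₂ (x , inj₁ u~x) = inj₂ (x , inj₁ (F⊆F′ u x u~x))
  ... | inj₂ (x , inj₂ v~x) = inj₂ (x , inj₂ (F⊆F′ v x v~x))

  IsEDS? : Decidable (IsEDS {G = G})
  IsEDS? F = all? λ u → all? λ v → T? (adj G u v) →-dec
    (T? (mem F u v) ⊎-dec any? λ x → T? (mem F u x) ⊎-dec T? (mem F v x))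

  edgesAvoiding-avoids : ∀ y x → ¬ T (mem (edgesAvoiding G y) y x)
  edgesAvoiding-avoids y x yx =
    toWitnessFalse {a? = y ≟ y} (proj₁ (to T-∧ (proj₂ (to (T-∧ {adj G y x}) yx)))) refl

  edgesAvoiding-∈ : ∀ {y u v} → T (adj G u v) → u ≢ y → v ≢ y → T (mem (edgesAvoiding G y) u v)
  edgesAvoiding-∈ {y} {u} {v} uv u≢y v≢y =
    from T-∧ (uv , from T-∧ (fromWitnessFalse {a? = u ≟ y} u≢y , fromWitnessFalse {a? = v ≟ y} v≢y))

  ¬support⇒edgeAvoidingAt : ∀ {y w} → ¬ IsSupport G y → T (adj G y w) →
                            ∃[ x ] T (mem (edgesAvoiding G y) w x)
  ¬support⇒edgeAvoidingAt ¬support yw with ¬support⇒otherNeighbour ¬support yw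
  ... | x , wx , x≢y = x , edgesAvoiding-∈ wx (adj⇒≢ yw ∘ sym) x≢y

  ¬support⇒edgesAvoiding-isEDS : ∀ {y} → ¬ IsSupport G y → IsEDS (edgesAvoiding G y)
  ¬support⇒edgesAvoiding-isEDS {y} ¬support u v uv = dominate (u ≟ y) (v ≟ y)
    where
    dominate : Dec (u ≡ y) → Dec (v ≡ y) → Dominated (edgesAvoiding G y) u v
    dominate (yes refl) _ =
      let x , vx = ¬support⇒edgeAvoidingAt ¬support uv
      in  inj₂ (x , inj₂ vx)
    dominate (no _) (yes refl) =
      let x , ux = ¬support⇒edgeAvoidingAt ¬support (subst T (Graph.sym G u v) uv)
      in  inj₂ (x , inj₁ ux)
    dominate (no u≢y) (no v≢y) = inj₁ (edgesAvoiding-∈ uv u≢y v≢y)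

lemma1p7 : ∀ {n : ℕ} (G : Graph n) (side : Fin n → Bool)
           → IsBipartition G side
           → sizeA side < sizeB side
           → WellEdgeDominated G
           → (y : Fin n) → side y ≡ false
           → ¬ IsSupport G y
           → ∃[ F ] (IsMinimalEDS {G = G} F × (∀ (x : Fin n) → ¬ T (mem F y x)))
lemma1p7 G _ _ _ _ y _ ¬support =
  let F , F⊆E[G-y] , F-minimal =
        minimal-⊆ {edgesAvoiding G y} (¬support⇒edgesAvoiding-isEDS {G = G} ¬support)
  in  F , F-minimal , λ x → edgesAvoiding-avoids {G = G} y x ∘ F⊆E[G-y] y x
  where open Pruning {G = G} IsEDS IsEDS? (λ {F} {F′} → IsEDS-upwardClosed {G = G} {F} {F′})
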